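{- Let $A$ and $B$ be nonempty polylines (up to translation). Suppose the closed polyline $S$ is the concatenation of translated copies of $A$, $B$, $A^{ -1}$, $B^{ -1}$, in this order (i.e. $S$ realises the template $\mathsf{A}\mathsf{B}\mathsf{A}^{ -1}\mathsf{B}^{ -1}$). Let $\mathbf{u}=\sigma(A)$ and $\mathbf{v}=\sigma(B)$. Then $\operatorname{area}(S)=\mathbf{u}\times\mathbf{v}$.
   Context: A polyline is an oriented curve made of finitely many straight segments. Its reverse $X^{ -1}$ is the same curve traversed backwards. The span $\sigma(X)$ is the vector from the initial point to the final point of $X$. For a closed polyline $S$ (possibly self-intersecting), $\operatorname{area}(S)$ is the oriented area it encloses, i.e. $\int_{\mathbb{R}^2}\operatorname{wind}(P,S)\,dP$, equivalently the shoelace sum. For vectors $(x_1,y_1)$ and $(x_2,y_2)$, $(x_1,y_1)\times(x_2,y_2)=x_1y_2-y_1x_2$. -}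

module Defs where

open import Level using (_⊔_)
open import Algebra.Bundles using (CommutativeRing)
open import Data.Product using (_×_; _,_)
open import Data.List using (List; []; _∷_)
import Data.List as List
open import Data.List.NonEmpty using (List⁺; _∷_; toList; reverse; last; head; tail; map; _⁺++_)
open import Data.List.Relation.Binary.Pointwise using (Pointwise)

-- Planar geometry of polylines over a commutative ring R in which 2 is
-- invertible (half + half ≈ 1#).  Instantiating R with the reals gives the
-- setting of the paper.
module Geometry {c ℓ} (R : CommutativeRing c ℓ) (half : CommutativeRing.Carrier R) where
  open CommutativeRing R

  Point : Set c
  Point = Carrier × Carrier

  _+ᵥ_ : Point → Point → Point
  (x₁ , y₁) +ᵥ (x₂ , y₂) = (x₁ + x₂ , y₁ + y₂)

  _-ᵥ_ : Point → Point → Point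
  (x₁ , y₁) -ᵥ (x₂ , y₂) = (x₁ - x₂ , y₁ - y₂)

  _≈ₚ_ : Point → Point → Set ℓ
  (x₁ , y₁) ≈ₚ (x₂ , y₂) = (x₁ ≈ x₂) × (y₁ ≈ y₂)

  cross : Point → Point → Carrier
  cross (x₁ , y₁) (x₂ , y₂) = x₁ * y₂ - y₁ * x₂

  -- A polyline is given by its (nonempty) sequence of vertices p₀,…,pₙ;
  -- its segments are [pᵢ,pᵢ₊₁].
  Polyline : Set c
  Polyline = List⁺ Point

  -- "nonempty": at least one segment
  NonEmptyPolyline : Polyline → Set
  NonEmptyPolyline X = 1 Data.Nat.≤ List.length (tail X)
    where import Data.Nat

  _≈ᴾ_ : Polyline → Polyline → Set (c ⊔ ℓ)
  X ≈ᴾ Y = Pointwise _≈ₚ_ (toList X) (toList Y)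

  σ : Polyline → Point
  σ X = last X -ᵥ head X

  _⁻¹ᴾ : Polyline → Polyline
  X ⁻¹ᴾ = reverse X

  translate : Point → Polyline → Polyline
  translate t X = map (_+ᵥ t) X

  at : Point → Polyline → Polyline
  at p X = translate (p -ᵥ head X) X

  _⊙_ : Polyline → Polyline → Polyline
  X ⊙ Y = X ⁺++ tail (at (last X) Y)
  infixr 5 _⊙_

  Closed : Polyline → Set ℓ
  Closed X = last X ≈ₚ head X

  shoelaceSum : List Point → Carrier
  shoelaceSum []            = 0#
  shoelaceSum (p ∷ [])      = 0#
  shoelaceSum (p ∷ q ∷ ps)  = cross p q + shoelaceSum (q ∷ ps)

  area : Polyline → Carrier
  area S = half * shoelaceSum (toList S)

-- Let C X be the shoelace sum of X closed up by the chord from its last vertex back to its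
-- first, i.e. twice the area enclosed by X and that chord.  C is translation invariant,
-- C (X⁻¹) = - C X, and gluing behaves like the product of the Heisenberg group:
-- C (X ⊙ Y) = C X + C Y + σ X × σ Y and σ (X ⊙ Y) = σ X + σ Y, the cross term being twice the
-- area of the triangle cut off by the new chord.  The commutator A B A⁻¹ B⁻¹ therefore has
-- C = 2 u × v, and since S is closed its chord is degenerate, so area S = C S / 2 = u × v.
module Submission where

open import Algebra.Bundles using (CommutativeRing; AbelianGroup)
open import Algebra.Construct.DirectProduct using () renaming (abelianGroup to ×-abelianGroup)
open import Data.List as List using (List; []; _∷_; _++_; [_])
open import Data.List.Properties using (unfold-reverse; ++-identityʳ)
open import Data.List.NonEmpty as List⁺
  using (List⁺; _∷_; _∷⁺_; _⁺++_; _⁺∷ʳ_; toList; head; tail; last; map; reverse)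
open import Data.List.Relation.Binary.Pointwise as Pointwise using (Pointwise; []; _∷_)
import Data.Vec as Vec
import Data.Vec.Properties as Vec
open import Data.Nat.Base using (suc)
open import Data.Product.Base using (_,_)
open import Relation.Binary.Core using (Rel)
open import Relation.Binary.PropositionalEquality as ≡ using (_≡_; cong)
open import Defs

module _ {a} {A : Set a} where

  last-∷ : (x y : A) (ys : List A) → last (x ∷ y ∷ ys) ≡ last (y ∷ ys)
  last-∷ x y ys with List.initLast ys
  ... | []             = ≡.refl
  ... | _ List.∷ʳ′ _   = ≡.refl

  last-⁺++ : (x : A) (xs : List A) (y : A) (ys : List A) →
             last ((x ∷ xs) ⁺++ y ∷ ys) ≡ last (y ∷ ys)
  last-⁺++ x []        y ys = last-∷ x y ys
  last-⁺++ x (x′ ∷ xs) y ys = ≡.trans (last-∷ x x′ (xs ++ y ∷ ys)) (last-⁺++ x′ xs y ys)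

  last-⁺∷ʳ : (X : List⁺ A) (y : A) → last (X ⁺∷ʳ y) ≡ y
  last-⁺∷ʳ (x ∷ xs) y = last-⁺++ x xs y []

  last-cong : ∀ {r} {R : Rel A r} {X Y : List⁺ A} →
              Pointwise R (toList X) (toList Y) → R (last X) (last Y)
  last-cong {X = _ ∷ []} {Y = _ ∷ []} (r ∷ []) = r
  last-cong {X = x ∷ x′ ∷ xs} {Y = y ∷ y′ ∷ ys} (_ ∷ rs)
    rewrite last-∷ x x′ xs | last-∷ y y′ ys = last-cong {X = x′ ∷ xs} {Y = y′ ∷ ys} rs

  toList-injective : {X Y : List⁺ A} → toList X ≡ toList Y → X ≡ Y
  toList-injective {_ ∷ _} {_ ∷ _} ≡.refl = ≡.refl

  toList-reverse : (X : List⁺ A) → toList (reverse X) ≡ List.reverse (toList X)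
  toList-reverse (x ∷ xs) = ≡.trans (toList-fromVec (Vec.reverse (x Vec.∷ Vec.fromList xs)))
    (≡.trans (Vec.toList-reverse (x Vec.∷ Vec.fromList xs))
             (cong List.reverse (Vec.toList∘fromList (x ∷ xs))))
    where
    toList-fromVec : ∀ {n} (v : Vec.Vec A (suc n)) → toList (List⁺.fromVec v) ≡ Vec.toList v
    toList-fromVec (_ Vec.∷ _) = ≡.refl

  reverse-∷⁺ : (x : A) (X : List⁺ A) → reverse (x ∷⁺ X) ≡ reverse X ⁺∷ʳ x
  reverse-∷⁺ x X = toList-injective (≡.trans (toList-reverse (x ∷⁺ X))
    (≡.trans (unfold-reverse x (toList X)) (cong (List._∷ʳ x) (≡.sym (toList-reverse X)))))

  last-reverse : (X : List⁺ A) → last (reverse X) ≡ head X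
  last-reverse (x ∷ [])     = ≡.refl
  last-reverse (x ∷ y ∷ ys) =
    ≡.trans (cong last (reverse-∷⁺ x (y ∷ ys))) (last-⁺∷ʳ (reverse (y ∷ ys)) x)

  head-reverse : (x : A) (xs : List A) → head (reverse (x ∷ xs)) ≡ last (x ∷ xs)
  head-reverse x []       = ≡.refl
  head-reverse x (y ∷ ys) = ≡.trans (cong head (reverse-∷⁺ x (y ∷ ys)))
    (≡.trans (head-reverse y ys) (≡.sym (last-∷ x y ys)))

last-map : ∀ {a b} {A : Set a} {B : Set b} (f : A → B) (x : A) (xs : List A) →
           last (map f (x ∷ xs)) ≡ f (last (x ∷ xs))
last-map f x []       = ≡.refl
last-map f x (y ∷ ys) = ≡.trans (last-∷ (f x) (f y) (List.map f ys))
  (≡.trans (last-map f y ys) (cong f (≡.sym (last-∷ x y ys))))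

module Polylines {c ℓ} (R : CommutativeRing c ℓ) (half : CommutativeRing.Carrier R) where

  open Geometry R half
  open CommutativeRing R using (+-abelianGroup)

  -- The product abelian group of points: its _∙_, _⁻¹ and x ∙ y ⁻¹ are
  -- definitionally _+ᵥ_, componentwise negation and _-ᵥ_.
  module V where
    open AbelianGroup (×-abelianGroup +-abelianGroup +-abelianGroup) public
    open import Algebra.Properties.AbelianGroup (×-abelianGroup +-abelianGroup +-abelianGroup) public
    open import Algebra.Properties.CommutativeSemigroup commutativeSemigroup public using (interchange)
    open import Relation.Binary.Reasoning.Setoid setoid

    sub-translate : ∀ x y t → ((x +ᵥ t) -ᵥ (y +ᵥ t)) ≈ₚ (x -ᵥ y)
    sub-translate x y t = begin
      (x +ᵥ t) -ᵥ (y +ᵥ t)              ≈⟨ ∙-congˡ (⁻¹-∙-comm y t) ⟨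
      (x +ᵥ t) +ᵥ ((y ⁻¹) +ᵥ (t ⁻¹))    ≈⟨ interchange x t (y ⁻¹) (t ⁻¹) ⟩
      (x -ᵥ y) +ᵥ (t -ᵥ t)              ≈⟨ ∙-congˡ (inverseʳ t) ⟩
      (x -ᵥ y) +ᵥ ε                     ≈⟨ identityʳ _ ⟩
      x -ᵥ y                            ∎

    sub-telescope : ∀ h m l → ((m -ᵥ h) +ᵥ (l -ᵥ m)) ≈ₚ (l -ᵥ h)
    sub-telescope h m l =
      trans (comm _ _) (trans (sym (assoc (l -ᵥ m) m (h ⁻¹))) (∙-congʳ (//-rightDividesˡ m l)))

  open CommutativeRing R
  open import Algebra.Properties.Ring ring
    using (-0#≈0#; -‿involutive; -‿+-comm; -‿distribˡ-*; -‿distribʳ-*; +-cancelʳ; xyx⁻¹≈y; \\-leftDividesˡ)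
  open import Algebra.Properties.CommutativeSemigroup +-commutativeSemigroup
    using (interchange; xy∙z≈xz∙y; xy∙z≈x∙zy)
  open import Relation.Binary.Reasoning.Setoid setoid

  cross-cong : ∀ {p p′ q q′} → p ≈ₚ p′ → q ≈ₚ q′ → cross p q ≈ cross p′ q′
  cross-cong (e₁ , e₂) (f₁ , f₂) = +-cong (*-cong e₁ f₂) (-‿cong (*-cong e₂ f₁))

  cross-distribˡ : ∀ p q r → cross p (q +ᵥ r) ≈ cross p q + cross p r
  cross-distribˡ (p₁ , p₂) (q₁ , q₂) (r₁ , r₂) = begin
    p₁ * (q₂ + r₂) - p₂ * (q₁ + r₁)
      ≈⟨ +-cong (distribˡ p₁ q₂ r₂) (-‿cong (distribˡ p₂ q₁ r₁)) ⟩
    (p₁ * q₂ + p₁ * r₂) - (p₂ * q₁ + p₂ * r₁)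
      ≈⟨ +-congˡ (-‿+-comm _ _) ⟨
    (p₁ * q₂ + p₁ * r₂) + (- (p₂ * q₁) - p₂ * r₁)
      ≈⟨ interchange _ _ _ _ ⟩
    (p₁ * q₂ - p₂ * q₁) + (p₁ * r₂ - p₂ * r₁) ∎

  cross-antisym : ∀ p q → cross q p ≈ - cross p q
  cross-antisym (p₁ , p₂) (q₁ , q₂) = begin
    q₁ * p₂ - q₂ * p₁
      ≈⟨ +-comm _ _ ⟩
    - (q₂ * p₁) + q₁ * p₂
      ≈⟨ +-cong (-‿cong (*-comm p₁ q₂)) (trans (-‿involutive _) (*-comm p₂ q₁)) ⟨
    - (p₁ * q₂) + - - (p₂ * q₁)
      ≈⟨ -‿+-comm _ _ ⟩
    - (p₁ * q₂ - p₂ * q₁) ∎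

  cross-distribʳ : ∀ p q r → cross (q +ᵥ r) p ≈ cross q p + cross r p
  cross-distribʳ p q r = begin
    cross (q +ᵥ r) p               ≈⟨ cross-antisym p (q +ᵥ r) ⟩
    - cross p (q +ᵥ r)             ≈⟨ -‿cong (cross-distribˡ p q r) ⟩
    - (cross p q + cross p r)      ≈⟨ -‿+-comm _ _ ⟨
    - cross p q + - cross p r      ≈⟨ +-cong (cross-antisym p q) (cross-antisym p r) ⟨
    cross q p + cross r p          ∎

  cross-inverse : ∀ p q → cross p q + cross q p ≈ 0#
  cross-inverse p q = trans (+-congˡ (cross-antisym p q)) (-‿inverseʳ _)

  cross-self : ∀ p → cross p p ≈ 0#
  cross-self (p₁ , p₂) = trans (+-congˡ (-‿cong (*-comm p₂ p₁))) (-‿inverseʳ _)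

  cross-negˡ : ∀ p q → cross (p V.⁻¹) q ≈ - cross p q
  cross-negˡ (p₁ , p₂) (q₁ , q₂) =
    trans (+-cong (sym (-‿distribˡ-* p₁ q₂)) (-‿cong (sym (-‿distribˡ-* p₂ q₁)))) (-‿+-comm _ _)

  cross-negʳ : ∀ p q → cross p (q V.⁻¹) ≈ - cross p q
  cross-negʳ (p₁ , p₂) (q₁ , q₂) =
    trans (+-cong (sym (-‿distribʳ-* p₁ q₂)) (-‿cong (sym (-‿distribʳ-* p₂ q₁)))) (-‿+-comm _ _)

  cross-neg-neg : ∀ p q → cross (p V.⁻¹) (q V.⁻¹) ≈ cross p q
  cross-neg-neg p q = trans (cross-negˡ p (q V.⁻¹)) (trans (-‿cong (cross-negʳ p q)) (-‿involutive _))

  cross-neg-self : ∀ p → cross p (p V.⁻¹) ≈ 0#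
  cross-neg-self p = trans (cross-negʳ p p) (trans (-‿cong (cross-self p)) -0#≈0#)

  cross-translate : ∀ x y t → cross (x +ᵥ t) (y +ᵥ t) + cross t x ≈ cross x y + cross t y
  cross-translate x y t = begin
    cross (x +ᵥ t) (y +ᵥ t) + cross t x
      ≈⟨ +-congʳ (cross-distribʳ (y +ᵥ t) x t) ⟩
    (cross x (y +ᵥ t) + cross t (y +ᵥ t)) + cross t x
      ≈⟨ +-congʳ (+-cong (cross-distribˡ x y t) (cross-distribˡ t y t)) ⟩
    ((cross x y + cross x t) + (cross t y + cross t t)) + cross t x
      ≈⟨ +-congʳ (+-congˡ (trans (+-congˡ (cross-self t)) (+-identityʳ _))) ⟩
    ((cross x y + cross x t) + cross t y) + cross t x
      ≈⟨ +-congʳ (xy∙z≈xz∙y _ _ _) ⟩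
    ((cross x y + cross t y) + cross x t) + cross t x
      ≈⟨ +-assoc _ _ _ ⟩
    (cross x y + cross t y) + (cross x t + cross t x)
      ≈⟨ +-congˡ (cross-inverse x t) ⟩
    (cross x y + cross t y) + 0#
      ≈⟨ +-identityʳ _ ⟩
    cross x y + cross t y ∎

  -- cross (m -ᵥ h) (l -ᵥ m) is twice the signed area of the triangle h m l.
  cross-triangle : ∀ h m l → cross l h ≈ (cross m h + cross l m) + cross (m -ᵥ h) (l -ᵥ m)
  cross-triangle h m l = sym (begin
    (cross m h + cross l m) + cross (m -ᵥ h) (l -ᵥ m)
      ≈⟨ +-congˡ expand ⟩
    (cross m h + cross l m) + ((cross m l + cross h m) + cross l h)
      ≈⟨ +-assoc _ _ _ ⟨
    ((cross m h + cross l m) + (cross m l + cross h m)) + cross l h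
      ≈⟨ +-congʳ (trans (+-congˡ (+-comm _ _)) (interchange _ _ _ _)) ⟩
    ((cross m h + cross h m) + (cross l m + cross m l)) + cross l h
      ≈⟨ +-congʳ (+-cong (cross-inverse m h) (cross-inverse l m)) ⟩
    (0# + 0#) + cross l h
      ≈⟨ trans (+-congʳ (+-identityˡ 0#)) (+-identityˡ _) ⟩
    cross l h ∎)
    where
    expand : cross (m -ᵥ h) (l -ᵥ m) ≈ (cross m l + cross h m) + cross l h
    expand = begin
      cross (m -ᵥ h) (l -ᵥ m)
        ≈⟨ cross-distribʳ (l -ᵥ m) m (h V.⁻¹) ⟩
      cross m (l -ᵥ m) + cross (h V.⁻¹) (l -ᵥ m)
        ≈⟨ +-cong (cross-distribˡ m l (m V.⁻¹)) (cross-distribˡ (h V.⁻¹) l (m V.⁻¹)) ⟩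
      (cross m l + cross m (m V.⁻¹)) + (cross (h V.⁻¹) l + cross (h V.⁻¹) (m V.⁻¹))
        ≈⟨ +-cong (+-congˡ (cross-neg-self m))
                  (+-cong (trans (cross-negˡ h l) (sym (cross-antisym h l))) (cross-neg-neg h m)) ⟩
      (cross m l + 0#) + (cross l h + cross h m)
        ≈⟨ +-cong (+-identityʳ _) (+-comm _ _) ⟩
      cross m l + (cross h m + cross l h)
        ≈⟨ +-assoc _ _ _ ⟨
      (cross m l + cross h m) + cross l h ∎

  shoelace : Polyline → Carrier
  shoelace X = shoelaceSum (toList X)

  closedShoelace : Polyline → Carrier
  closedShoelace X = shoelace X + cross (last X) (head X)

  shoelaceSum-cong : ∀ {ps qs} → Pointwise _≈ₚ_ ps qs → shoelaceSum ps ≈ shoelaceSum qs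
  shoelaceSum-cong []                = refl
  shoelaceSum-cong (_ ∷ [])          = refl
  shoelaceSum-cong (e ∷ es@(e′ ∷ _)) = +-cong (cross-cong e e′) (shoelaceSum-cong es)

  shoelace-⁺++ : ∀ x xs ys →
    shoelace ((x ∷ xs) ⁺++ ys) ≈ shoelace (x ∷ xs) + shoelaceSum (last (x ∷ xs) ∷ ys)
  shoelace-⁺++ x []       ys = sym (+-identityˡ _)
  shoelace-⁺++ x (y ∷ xs) ys = begin
    cross x y + shoelace ((y ∷ xs) ⁺++ ys)
      ≈⟨ +-congˡ (shoelace-⁺++ y xs ys) ⟩
    cross x y + (shoelace (y ∷ xs) + shoelaceSum (last (y ∷ xs) ∷ ys))
      ≈⟨ +-assoc _ _ _ ⟨
    shoelace (x ∷ y ∷ xs) + shoelaceSum (last (y ∷ xs) ∷ ys)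
      ≡⟨ cong (λ p → shoelace (x ∷ y ∷ xs) + shoelaceSum (p ∷ ys)) (last-∷ x y xs) ⟨
    shoelace (x ∷ y ∷ xs) + shoelaceSum (last (x ∷ y ∷ xs) ∷ ys) ∎

  shoelace-translate : ∀ t x xs →
    shoelace (translate t (x ∷ xs)) + cross t x ≈ shoelace (x ∷ xs) + cross t (last (x ∷ xs))
  shoelace-translate t x []       = refl
  shoelace-translate t x (y ∷ ys) = begin
    (cross (x +ᵥ t) (y +ᵥ t) + shoelace (translate t (y ∷ ys))) + cross t x
      ≈⟨ xy∙z≈xz∙y _ _ _ ⟩
    (cross (x +ᵥ t) (y +ᵥ t) + cross t x) + shoelace (translate t (y ∷ ys))
      ≈⟨ +-congʳ (cross-translate x y t) ⟩
    (cross x y + cross t y) + shoelace (translate t (y ∷ ys))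
      ≈⟨ xy∙z≈x∙zy _ _ _ ⟩
    cross x y + (shoelace (translate t (y ∷ ys)) + cross t y)
      ≈⟨ +-congˡ (shoelace-translate t y ys) ⟩
    cross x y + (shoelace (y ∷ ys) + cross t (last (y ∷ ys)))
      ≈⟨ +-assoc _ _ _ ⟨
    shoelace (x ∷ y ∷ ys) + cross t (last (y ∷ ys))
      ≡⟨ cong (λ p → shoelace (x ∷ y ∷ ys) + cross t p) (last-∷ x y ys) ⟨
    shoelace (x ∷ y ∷ ys) + cross t (last (x ∷ y ∷ ys)) ∎

  shoelace-reverse : ∀ x xs → shoelace (reverse (x ∷ xs)) ≈ - shoelace (x ∷ xs)
  shoelace-reverse x []       = sym -0#≈0#
  shoelace-reverse x (y ∷ ys) = begin
    shoelace (reverse (x ∷ y ∷ ys))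
      ≡⟨ cong shoelace (reverse-∷⁺ x (y ∷ ys)) ⟩
    shoelace (reverse (y ∷ ys) ⁺∷ʳ x)
      ≈⟨ shoelace-⁺++ (head (reverse (y ∷ ys))) (tail (reverse (y ∷ ys))) [ x ] ⟩
    shoelace (reverse (y ∷ ys)) + (cross (last (reverse (y ∷ ys))) x + 0#)
      ≈⟨ +-cong (shoelace-reverse y ys) (+-identityʳ _) ⟩
    - shoelace (y ∷ ys) + cross (last (reverse (y ∷ ys))) x
      ≡⟨ cong (λ p → - shoelace (y ∷ ys) + cross p x) (last-reverse (y ∷ ys)) ⟩
    - shoelace (y ∷ ys) + cross y x
      ≈⟨ +-congˡ (cross-antisym x y) ⟩
    - shoelace (y ∷ ys) + - cross x y
      ≈⟨ trans (+-comm _ _) (-‿+-comm _ _) ⟩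
    - shoelace (x ∷ y ∷ ys) ∎

  closedShoelace-cong : ∀ {X Y} → X ≈ᴾ Y → closedShoelace X ≈ closedShoelace Y
  closedShoelace-cong e@(e₀ ∷ _) = +-cong (shoelaceSum-cong e) (cross-cong (last-cong e) e₀)

  shoelace-closed : ∀ S → Closed S → shoelace S ≈ closedShoelace S
  shoelace-closed S closed =
    sym (trans (+-congˡ (trans (cross-cong closed V.refl) (cross-self _))) (+-identityʳ _))

  σ-translate : ∀ t X → σ (translate t X) ≈ₚ σ X
  σ-translate t (x ∷ xs) =
    V.trans (V.∙-congʳ (V.reflexive (last-map (_+ᵥ t) x xs))) (V.sub-translate _ x t)

  closedShoelace-translate : ∀ t X → closedShoelace (translate t X) ≈ closedShoelace X
  closedShoelace-translate t (x ∷ xs) =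
    trans (+-congˡ (cross-cong (V.reflexive (last-map (_+ᵥ t) x xs)) V.refl))
          (+-cancelʳ (cross t x + cross t l) _ _ (begin
      (s′ + cross (l +ᵥ t) (x +ᵥ t)) + (cross t x + cross t l)
        ≈⟨ interchange _ _ _ _ ⟩
      (s′ + cross t x) + (cross (l +ᵥ t) (x +ᵥ t) + cross t l)
        ≈⟨ +-cong (shoelace-translate t x xs) (cross-translate l x t) ⟩
      (s + cross t l) + (cross l x + cross t x)
        ≈⟨ interchange _ _ _ _ ⟩
      (s + cross l x) + (cross t l + cross t x)
        ≈⟨ +-congˡ (+-comm _ _) ⟩
      (s + cross l x) + (cross t x + cross t l) ∎))
    where
    l = last (x ∷ xs)
    s = shoelace (x ∷ xs)
    s′ = shoelace (translate t (x ∷ xs))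

  σ-⁻¹ᴾ : ∀ X → σ (X ⁻¹ᴾ) ≈ₚ (σ X V.⁻¹)
  σ-⁻¹ᴾ (x ∷ xs) =
    V.trans (V.∙-cong (V.reflexive (last-reverse (x ∷ xs))) (V.⁻¹-cong (V.reflexive (head-reverse x xs))))
            (V.sym (V.⁻¹-anti-homo‿- (last (x ∷ xs)) x))

  closedShoelace-⁻¹ᴾ : ∀ X → closedShoelace (X ⁻¹ᴾ) ≈ - closedShoelace X
  closedShoelace-⁻¹ᴾ (x ∷ xs) = begin
    shoelace (reverse (x ∷ xs)) + cross (last (reverse (x ∷ xs))) (head (reverse (x ∷ xs)))
      ≈⟨ +-cong (shoelace-reverse x xs)
                (cross-cong (V.reflexive (last-reverse (x ∷ xs))) (V.reflexive (head-reverse x xs))) ⟩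
    - shoelace (x ∷ xs) + cross x (last (x ∷ xs))
      ≈⟨ +-congˡ (cross-antisym (last (x ∷ xs)) x) ⟩
    - shoelace (x ∷ xs) + - cross (last (x ∷ xs)) x
      ≈⟨ -‿+-comm _ _ ⟩
    - closedShoelace (x ∷ xs) ∎

  last-join : ∀ X Y → head Y ≈ₚ last X → last (X ⁺++ tail Y) ≈ₚ last Y
  last-join (x ∷ xs) (y ∷ [])     e =
    V.trans (V.reflexive (cong (λ t → last (x ∷ t)) (++-identityʳ xs))) (V.sym e)
  last-join (x ∷ xs) (y ∷ z ∷ zs) e = V.reflexive (≡.trans (last-⁺++ x xs z zs) (≡.sym (last-∷ y z zs)))

  shoelace-join : ∀ X Y → head Y ≈ₚ last X → shoelace (X ⁺++ tail Y) ≈ shoelace X + shoelace Y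
  shoelace-join (x ∷ xs) (y ∷ ys) e =
    trans (shoelace-⁺++ x xs ys) (+-congˡ (shoelaceSum-cong (V.sym e ∷ Pointwise.refl V.refl {ys})))

  σ-join : ∀ X Y → head Y ≈ₚ last X → σ (X ⁺++ tail Y) ≈ₚ (σ X +ᵥ σ Y)
  σ-join X Y e = V.trans (V.∙-congʳ (last-join X Y e))
    (V.sym (V.trans (V.∙-congˡ (V.∙-congˡ (V.⁻¹-cong e))) (V.sub-telescope (head X) (last X) (last Y))))

  closedShoelace-join : ∀ X Y → head Y ≈ₚ last X →
    closedShoelace (X ⁺++ tail Y) ≈ (closedShoelace X + closedShoelace Y) + cross (σ X) (σ Y)
  closedShoelace-join X Y e = begin
    shoelace (X ⁺++ tail Y) + cross (last (X ⁺++ tail Y)) h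
      ≈⟨ +-cong (shoelace-join X Y e) (cross-cong (last-join X Y e) V.refl) ⟩
    (shoelace X + shoelace Y) + cross l h
      ≈⟨ +-congˡ (cross-triangle h m l) ⟩
    (shoelace X + shoelace Y) + ((cross m h + cross l m) + cross (m -ᵥ h) (l -ᵥ m))
      ≈⟨ trans (+-congʳ (interchange _ _ _ _)) (+-assoc _ _ _) ⟨
    ((shoelace X + cross m h) + (shoelace Y + cross l m)) + cross (m -ᵥ h) (l -ᵥ m)
      ≈⟨ +-cong (+-congˡ (+-congˡ (cross-cong V.refl e)))
                (cross-cong V.refl (V.∙-congˡ (V.⁻¹-cong e))) ⟨
    (closedShoelace X + closedShoelace Y) + cross (σ X) (σ Y) ∎
    where
    h = head X
    m = last X
    l = last Y

  head-at : ∀ p X → head (at p X) ≈ₚ p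
  head-at p X = V.trans (V.comm (head X) _) (V.//-rightDividesˡ (head X) p)

  σ-⊙ : ∀ X Y → σ (X ⊙ Y) ≈ₚ (σ X +ᵥ σ Y)
  σ-⊙ X Y = V.trans (σ-join X (at (last X) Y) (head-at (last X) Y)) (V.∙-congˡ (σ-translate _ Y))

  closedShoelace-⊙ : ∀ X Y →
    closedShoelace (X ⊙ Y) ≈ (closedShoelace X + closedShoelace Y) + cross (σ X) (σ Y)
  closedShoelace-⊙ X Y = trans (closedShoelace-join X (at (last X) Y) (head-at (last X) Y))
    (+-cong (+-congˡ (closedShoelace-translate _ Y)) (cross-cong V.refl (σ-translate _ Y)))

  -- For g = (c , u), h = (d , v) in the Heisenberg group with product
  -- (c , u) · (d , v) = (c + d + cross u v , u +ᵥ v), the left side is the first component of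
  -- g · (h · (g⁻¹ · h⁻¹)), where g⁻¹ = (- c , u V.⁻¹).
  heisenberg-commutator : ∀ c d u v →
    (c + ((d + ((- c + - d) + cross (u V.⁻¹) (v V.⁻¹))) + cross v ((u V.⁻¹) +ᵥ (v V.⁻¹))))
      + cross u (v +ᵥ ((u V.⁻¹) +ᵥ (v V.⁻¹)))
    ≈ cross u v + cross u v
  heisenberg-commutator c d u v = begin
    (c + ((d + ((- c + - d) + cross (u V.⁻¹) (v V.⁻¹))) + cross v ((u V.⁻¹) +ᵥ (v V.⁻¹))))
      + cross u (v +ᵥ ((u V.⁻¹) +ᵥ (v V.⁻¹)))
      ≈⟨ +-cong (+-congˡ (+-cong (+-congˡ (+-congˡ (cross-neg-neg u v))) cross-v)) cross-u ⟩
    (c + ((d + ((- c + - d) + w)) + w)) + 0#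
      ≈⟨ +-identityʳ _ ⟩
    c + ((d + ((- c + - d) + w)) + w)
      ≈⟨ +-congˡ (+-congʳ (trans (sym (+-assoc d _ w)) (+-congʳ cancel-d))) ⟩
    c + ((- c + w) + w)
      ≈⟨ +-congˡ (+-assoc _ _ _) ⟩
    c + (- c + (w + w))
      ≈⟨ \\-leftDividesˡ c (w + w) ⟩
    w + w ∎
    where
    w = cross u v
    cancel-d : d + (- c + - d) ≈ - c
    cancel-d = trans (sym (+-assoc d (- c) (- d))) (xyx⁻¹≈y d (- c))
    cross-v : cross v ((u V.⁻¹) +ᵥ (v V.⁻¹)) ≈ w
    cross-v = begin
      cross v ((u V.⁻¹) +ᵥ (v V.⁻¹))         ≈⟨ cross-distribˡ v _ _ ⟩
      cross v (u V.⁻¹) + cross v (v V.⁻¹)   ≈⟨ +-cong (cross-negʳ v u) (cross-neg-self v) ⟩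
      - cross v u + 0#                      ≈⟨ +-identityʳ _ ⟩
      - cross v u                           ≈⟨ -‿cong (cross-antisym u v) ⟩
      - - w                                 ≈⟨ -‿involutive w ⟩
      w ∎
    cross-u : cross u (v +ᵥ ((u V.⁻¹) +ᵥ (v V.⁻¹))) ≈ 0#
    cross-u =
      trans (cross-cong V.refl (V.trans (V.sym (V.assoc v _ _)) (V.xyx⁻¹≈y v (u V.⁻¹)))) (cross-neg-self u)

  closedShoelace-commutator : ∀ X Y →
    closedShoelace (X ⊙ Y ⊙ (X ⁻¹ᴾ) ⊙ (Y ⁻¹ᴾ)) ≈ cross (σ X) (σ Y) + cross (σ X) (σ Y)
  closedShoelace-commutator X Y = begin
    closedShoelace (X ⊙ Y ⊙ Q)
      ≈⟨ closedShoelace-⊙ X (Y ⊙ Q) ⟩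
    (closedShoelace X + closedShoelace (Y ⊙ Q)) + cross u (σ (Y ⊙ Q))
      ≈⟨ +-cong (+-congˡ C[Y⊙Q]) (cross-cong V.refl σ[Y⊙Q]) ⟩
    (closedShoelace X
       + ((closedShoelace Y + ((- closedShoelace X + - closedShoelace Y) + cross (u V.⁻¹) (v V.⁻¹)))
          + cross v ((u V.⁻¹) +ᵥ (v V.⁻¹))))
      + cross u (v +ᵥ ((u V.⁻¹) +ᵥ (v V.⁻¹)))
      ≈⟨ heisenberg-commutator _ _ u v ⟩
    cross u v + cross u v ∎
    where
    Q = (X ⁻¹ᴾ) ⊙ (Y ⁻¹ᴾ)
    u = σ X
    v = σ Y
    σ[Q] : σ Q ≈ₚ ((u V.⁻¹) +ᵥ (v V.⁻¹))
    σ[Q] = V.trans (σ-⊙ (X ⁻¹ᴾ) (Y ⁻¹ᴾ)) (V.∙-cong (σ-⁻¹ᴾ X) (σ-⁻¹ᴾ Y))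
    σ[Y⊙Q] : σ (Y ⊙ Q) ≈ₚ (v +ᵥ ((u V.⁻¹) +ᵥ (v V.⁻¹)))
    σ[Y⊙Q] = V.trans (σ-⊙ Y Q) (V.∙-congˡ σ[Q])
    C[Q] : closedShoelace Q ≈ (- closedShoelace X + - closedShoelace Y) + cross (u V.⁻¹) (v V.⁻¹)
    C[Q] = trans (closedShoelace-⊙ (X ⁻¹ᴾ) (Y ⁻¹ᴾ))
      (+-cong (+-cong (closedShoelace-⁻¹ᴾ X) (closedShoelace-⁻¹ᴾ Y)) (cross-cong (σ-⁻¹ᴾ X) (σ-⁻¹ᴾ Y)))
    C[Y⊙Q] : closedShoelace (Y ⊙ Q)
           ≈ (closedShoelace Y + ((- closedShoelace X + - closedShoelace Y) + cross (u V.⁻¹) (v V.⁻¹)))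
             + cross v ((u V.⁻¹) +ᵥ (v V.⁻¹))
    C[Y⊙Q] = trans (closedShoelace-⊙ Y Q) (+-cong (+-congˡ C[Q]) (cross-cong V.refl σ[Q]))

  half-double : half + half ≈ 1# → ∀ x → half * (x + x) ≈ x
  half-double half+half≈1 x = begin
    half * (x + x)          ≈⟨ distribˡ half x x ⟩
    half * x + half * x     ≈⟨ distribʳ x half half ⟨
    (half + half) * x       ≈⟨ *-congʳ half+half≈1 ⟩
    1# * x                  ≈⟨ *-identityˡ x ⟩
    x ∎

lemma1 : ∀ {c ℓ} (R : CommutativeRing c ℓ) (half : CommutativeRing.Carrier R) →
         let open CommutativeRing R in
         let open Geometry R half in
         half + half ≈ 1# →
         (A B S : Polyline) →
         NonEmptyPolyline A → NonEmptyPolyline B →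
         Closed S →
         (p : Point) →
         S ≈ᴾ at p (A ⊙ B ⊙ (A ⁻¹ᴾ) ⊙ (B ⁻¹ᴾ)) →
         area S ≈ cross (σ A) (σ B)
lemma1 R half half+half≈1 A B S _ _ closed p S≈P = begin
  half * shoelace S                               ≈⟨ *-congˡ (shoelace-closed S closed) ⟩
  half * closedShoelace S                         ≈⟨ *-congˡ (closedShoelace-cong S≈P) ⟩
  half * closedShoelace (at p P)                  ≈⟨ *-congˡ (closedShoelace-translate _ P) ⟩
  half * closedShoelace P                         ≈⟨ *-congˡ (closedShoelace-commutator A B) ⟩
  half * (cross (σ A) (σ B) + cross (σ A) (σ B))  ≈⟨ half-double half+half≈1 _ ⟩
  cross (σ A) (σ B)                               ∎
  where
  open CommutativeRing R
  open Geometry R half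
  open Polylines R half
  open import Relation.Binary.Reasoning.Setoid setoid
  P = A ⊙ B ⊙ (A ⁻¹ᴾ) ⊙ (B ⁻¹ᴾ)
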